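{- For every positive integer $n$, $r(n)\leq 2n+1$.
   Context: For positive integers $n$, $r_1$, $r_2$, consider the Diophantine equation $x_1^n+\cdots+x_{r_1}^n=y_1^n+\cdots+y_{r_2}^n$. A solution is non-trivial if all $x_i,y_j$ are positive integers and no $x_i$ equals any $y_j$. $r(n)$ denotes the smallest value of $r_1+r_2-1$ over all pairs of positive integers $(r_1,r_2)$ for which this equation has at least one non-trivial solution. -}

module Defs where

open import Data.Nat using (ℕ; zero; suc; _+_; _∸_; _^_; _≤_; _<_)
open import Data.Fin using (Fin; zero; suc)
open import Data.Product using (Σ; _×_; _,_)
open import Relation.Binary.PropositionalEquality using (_≡_; _≢_)

sumFin : (r : ℕ) → (Fin r → ℕ) → ℕ
sumFin zero    f = 0
sumFin (suc r) f = f zero + sumFin r (λ i → f (suc i))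

NontrivialSolution : (n r₁ r₂ : ℕ) → (Fin r₁ → ℕ) → (Fin r₂ → ℕ) → Set
NontrivialSolution n r₁ r₂ x y =
  ((i : Fin r₁) → 0 < x i) ×
  ((j : Fin r₂) → 0 < y j) ×
  ((i : Fin r₁) (j : Fin r₂) → x i ≢ y j) ×
  (sumFin r₁ (λ i → x i ^ n) ≡ sumFin r₂ (λ j → y j ^ n))

HasNontrivialSolution : (n r₁ r₂ : ℕ) → Set
HasNontrivialSolution n r₁ r₂ =
  Σ (Fin r₁ → ℕ) λ x → Σ (Fin r₂ → ℕ) λ y → NontrivialSolution n r₁ r₂ x y

-- "r(n) ≤ k": since r(n) is the minimum of r₁+r₂-1 over pairs of positive
-- integers (r₁,r₂) admitting a non-trivial solution, r(n) ≤ k holds exactly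
-- when some such pair has r₁ + r₂ - 1 ≤ k.
r≤ : (n k : ℕ) → Set
r≤ n k = Σ ℕ λ r₁ → Σ ℕ λ r₂ →
  (0 < r₁) × (0 < r₂) × (r₁ + r₂ ∸ 1 ≤ k) × HasNontrivialSolution n r₁ r₂

{-# OPTIONS --safe #-}
module Submission where

-- Cut 1, …, k·M into k = n + 1 blocks of M consecutive integers and pick one integer from each
-- block. The M ^ k choices have sums of n-th powers at most k · (k · M) ^ n, which is less than
-- M ^ k - 1 for M = k ^ k + 2, so two different choices have the same power sum. Cancelling the
-- blocks where they agree leaves r ≤ k integers on each side; they are pairwise distinct because
-- distinct blocks are disjoint, so r(n) ≤ 2k - 1 = 2n + 1.

open import Defs
open import Data.Nat using (ℕ; zero; suc; _+_; _*_; _∸_; _^_; _≤_; _<_; s≤s; z≤n)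
open import Data.Nat.Properties
  using ( +-assoc; +-mono-≤; +-monoˡ-≤; +-cancelˡ-≡; +-commutativeSemigroup; *-assoc
        ; [m*n]*[o*p]≡[m*o]*[n*p]; ^-monoˡ-≤; m^n>0; ∸-monoˡ-≤; suc-injective
        ; module ≤-Reasoning )
open import Data.Nat.ListAction using (sum)
open import Data.Nat.Solver using (module +-*-Solver)
open import Algebra.Properties.CommutativeSemigroup +-commutativeSemigroup
  using (x∙yz≈y∙xz)
open import Data.Fin using (Fin; toℕ; fromℕ<; combine; funToFin; finToFun)
import Data.Fin.Properties as Fin
open import Data.List using (List; []; _∷_; length; lookup; map; filter; allFin)
open import Data.List.Properties
  using (length-map; length-filter; length-tabulate; map-∘; map-cong-local; filter-some)
open import Data.List.Membership.Propositional using (_∈_; lose)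
open import Data.List.Membership.Propositional.Properties
  using (∈-lookup; ∈-map⁻; ∈-filter⁻; ∈-allFin)
import Data.List.Relation.Unary.All as All
open import Data.List.Relation.Unary.All.Properties using (all-filter)
open import Data.Product using (∃₂; _×_; _,_; proj₂)
open import Function using (_∘_; id)
open import Relation.Binary.PropositionalEquality
open import Relation.Nullary using (¬_; yes; no)
open import Relation.Unary using (Pred; Decidable)
open import Relation.Unary.Properties using (∁?)

sumFin-lookup : ∀ {A : Set} (f : A → ℕ) (xs : List A) →
                sumFin (length xs) (f ∘ lookup xs) ≡ sum (map f xs)
sumFin-lookup f []       = refl
sumFin-lookup f (x ∷ xs) = cong (f x +_) (sumFin-lookup f xs)

length-allFin : ∀ n → length (allFin n) ≡ n
length-allFin n = length-tabulate id

sum-map-≤ : ∀ {A : Set} {f : A → ℕ} {c} (xs : List A) →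
            (∀ x → f x ≤ c) → sum (map f xs) ≤ length xs * c
sum-map-≤ []       f≤c = z≤n
sum-map-≤ (x ∷ xs) f≤c = +-mono-≤ (f≤c x) (sum-map-≤ xs f≤c)

module _ {A : Set} {p} {P : Pred A p} (P? : Decidable P) where

  sum-map-filter-partition : ∀ (f : A → ℕ) xs →
    sum (map f xs) ≡ sum (map f (filter P? xs)) + sum (map f (filter (∁? P?) xs))
  sum-map-filter-partition f []       = refl
  sum-map-filter-partition f (x ∷ xs) with P? x
  ... | yes _ = trans (cong (f x +_) (sum-map-filter-partition f xs))
                      (sym (+-assoc (f x) (sum (map f (filter P? xs))) _))
  ... | no _  = trans (cong (f x +_) (sum-map-filter-partition f xs))
                      (x∙yz≈y∙xz (f x) (sum (map f (filter P? xs))) _)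

  sum-map-∁-filter-cancel : ∀ {f g : A → ℕ} → (∀ {x} → P x → f x ≡ g x) →
    ∀ xs → sum (map f xs) ≡ sum (map g xs) →
    sum (map f (filter (∁? P?) xs)) ≡ sum (map g (filter (∁? P?) xs))
  sum-map-∁-filter-cancel {f} {g} f≡g xs Σf≡Σg = +-cancelˡ-≡ (sum (map f kept)) _ _ (begin
      sum (map f kept) + sum (map f dropped) ≡⟨ sum-map-filter-partition f xs ⟨
      sum (map f xs)                         ≡⟨ Σf≡Σg ⟩
      sum (map g xs)                         ≡⟨ sum-map-filter-partition g xs ⟩
      sum (map g kept) + sum (map g dropped) ≡⟨ cong (λ ys → sum ys + _) f≡g-on-kept ⟨
      sum (map f kept) + sum (map g dropped) ∎)
    where
      open ≡-Reasoning
      kept dropped : List A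
      kept    = filter P? xs
      dropped = filter (∁? P?) xs
      f≡g-on-kept : map f kept ≡ map g kept
      f≡g-on-kept = map-cong-local (All.map f≡g (all-filter P? xs))

pigeonhole-ℕ : ∀ {m b} (f : Fin m → ℕ) → (∀ i → f i < b) → b < m →
               ∃₂ λ i j → i ≢ j × f i ≡ f j
pigeonhole-ℕ f f<b b<m
  with i , j , i<j , eq ← Fin.pigeonhole b<m (λ i → fromℕ< (f<b i)) =
  i , j , Fin.<⇒≢ i<j ,
  trans (sym (Fin.toℕ-fromℕ< (f<b i))) (trans (cong toℕ eq) (Fin.toℕ-fromℕ< (f<b j)))

funToFin-cong : ∀ {m n} {f g : Fin m → Fin n} → f ≗ g → funToFin f ≡ funToFin g
funToFin-cong {zero}  f≗g = refl
funToFin-cong {suc m} f≗g = cong₂ combine (f≗g Fin.zero) (funToFin-cong (f≗g ∘ Fin.suc))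

finToFun-injective : ∀ {m n} {i j : Fin (m ^ n)} →
                     finToFun {m} {n} i ≗ finToFun j → i ≡ j
finToFun-injective {m} {n} {i} {j} i≗j = begin
  i                             ≡⟨ Fin.funToFin-finToFin {n} {m} i ⟨
  funToFin {n} {m} (finToFun i) ≡⟨ funToFin-cong i≗j ⟩
  funToFin {n} {m} (finToFun j) ≡⟨ Fin.funToFin-finToFin {n} {m} j ⟩
  j                             ∎
  where open ≡-Reasoning

[m*n]^o≡m^o*n^o : ∀ m n o → (m * n) ^ o ≡ m ^ o * n ^ o
[m*n]^o≡m^o*n^o m n zero    = refl
[m*n]^o≡m^o*n^o m n (suc o) = begin
  m * n * (m * n) ^ o     ≡⟨ cong (m * n *_) ([m*n]^o≡m^o*n^o m n o) ⟩
  m * n * (m ^ o * n ^ o) ≡⟨ [m*n]*[o*p]≡[m*o]*[n*p] m n (m ^ o) (n ^ o) ⟩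
  m ^ suc o * n ^ suc o   ∎
  where open ≡-Reasoning

lookup-nontrivialSolution : ∀ n {xs ys : List ℕ} →
  (∀ {x} → x ∈ xs → 0 < x) → (∀ {y} → y ∈ ys → 0 < y) →
  (∀ {x y} → x ∈ xs → y ∈ ys → x ≢ y) →
  sum (map (_^ n) xs) ≡ sum (map (_^ n) ys) →
  NontrivialSolution n (length xs) (length ys) (lookup xs) (lookup ys)
lookup-nontrivialSolution n {xs} {ys} xs>0 ys>0 xs≢ys Σxs≡Σys =
  xs>0 ∘ ∈-lookup , ys>0 ∘ ∈-lookup , (λ i j → xs≢ys (∈-lookup i) (∈-lookup j)) ,
  trans (sumFin-lookup (_^ n) xs) (trans Σxs≡Σys (sym (sumFin-lookup (_^ n) ys)))

module Blocks (k M : ℕ) where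

  -- entry p d = p * M + d + 1, the d-th integer of the p-th block.
  entry : Fin k → Fin M → ℕ
  entry p d = suc (toℕ (combine p d))

  entry-injective : ∀ {p q d e} → entry p d ≡ entry q e → p ≡ q × d ≡ e
  entry-injective eq = Fin.combine-injective _ _ _ _ (Fin.toℕ-injective (suc-injective eq))

  entry≤ : ∀ p d → entry p d ≤ k * M
  entry≤ p d = Fin.toℕ<n (combine p d)

  powerSum : ℕ → (Fin k → Fin M) → ℕ
  powerSum n u = sum (map (λ p → entry p (u p) ^ n) (allFin k))

  powerSum≤ : ∀ n u → powerSum n u ≤ k * (k * M) ^ n
  powerSum≤ n u = subst (λ l → powerSum n u ≤ l * (k * M) ^ n) (length-allFin k)
    (sum-map-≤ (allFin k) (λ p → ^-monoˡ-≤ n (entry≤ p (u p))))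

  powerSum-collision : ∀ n → suc (k * (k * M) ^ n) < M ^ k →
    ∃₂ λ (u v : Fin k → Fin M) → ¬ (u ≗ v) × powerSum n u ≡ powerSum n v
  powerSum-collision n bound
    with i , j , i≢j , eq ← pigeonhole-ℕ (powerSum n ∘ finToFun {M} {k})
                                         (λ i → s≤s (powerSum≤ n (finToFun i))) bound
    = finToFun i , finToFun j , i≢j ∘ finToFun-injective , eq

  module Differing (u v : Fin k → Fin M) where

    u≟v : Decidable (λ p → u p ≡ v p)
    u≟v p = u p Fin.≟ v p

    differing : List (Fin k)
    differing = filter (∁? u≟v) (allFin k)

    entries : (Fin k → Fin M) → List ℕ
    entries w = map (λ p → entry p (w p)) differing

    length-entries : ∀ w → length (entries w) ≡ length differing
    length-entries w = length-map _ differing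

    length-differing≤ : length differing ≤ k
    length-differing≤ =
      subst (length differing ≤_) (length-allFin k) (length-filter (∁? u≟v) (allFin k))

    length-differing>0 : ¬ (u ≗ v) → 0 < length differing
    length-differing>0 u≉v with p , up≢vp ← Fin.¬∀⟶∃¬ k _ u≟v u≉v =
      filter-some (∁? u≟v) {allFin k} (lose (∈-allFin p) up≢vp)

    entries>0 : ∀ w {x} → x ∈ entries w → 0 < x
    entries>0 w x∈ with _ , _ , refl ← ∈-map⁻ _ x∈ = s≤s z≤n

    entries-disjoint : ∀ {x y} → x ∈ entries u → y ∈ entries v → x ≢ y
    entries-disjoint x∈ y∈ x≡y
      with p , p∈ , refl ← ∈-map⁻ _ x∈ | q , _ , refl ← ∈-map⁻ _ y∈
      with refl , up≡vp ← entry-injective x≡y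
      = proj₂ (∈-filter⁻ (∁? u≟v) {xs = allFin k} p∈) up≡vp

    entries-powerSum : ∀ n → powerSum n u ≡ powerSum n v →
      sum (map (_^ n) (entries u)) ≡ sum (map (_^ n) (entries v))
    entries-powerSum n Su≡Sv = begin
      sum (map (_^ n) (entries u))
        ≡⟨ cong sum (map-∘ differing) ⟨
      sum (map (λ p → entry p (u p) ^ n) differing)
        ≡⟨ sum-map-∁-filter-cancel u≟v (cong (λ d → entry _ d ^ n)) (allFin k) Su≡Sv ⟩
      sum (map (λ p → entry p (v p) ^ n) differing)
        ≡⟨ cong sum (map-∘ differing) ⟩
      sum (map (_^ n) (entries v))
        ∎
      where open ≡-Reasoning

  collision⇒r≤ : ∀ n → (∃₂ λ u v → ¬ (u ≗ v) × powerSum n u ≡ powerSum n v) →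
                 r≤ n (k + k ∸ 1)
  collision⇒r≤ n (u , v , u≉v , Su≡Sv) =
    length (entries u) , length (entries v) ,
    subst (0 <_) (sym (length-entries u)) (length-differing>0 u≉v) ,
    subst (0 <_) (sym (length-entries v)) (length-differing>0 u≉v) ,
    ∸-monoˡ-≤ 1 (+-mono-≤ (length-entries≤ u) (length-entries≤ v)) ,
    lookup (entries u) , lookup (entries v) ,
    lookup-nontrivialSolution n (entries>0 u) (entries>0 v) entries-disjoint
                              (entries-powerSum n Su≡Sv)
    where
      open Differing u v
      length-entries≤ : ∀ w → length (entries w) ≤ k
      length-entries≤ w = subst (_≤ k) (sym (length-entries w)) length-differing≤

suc[k*[k*M]^n]<M^k : ∀ n → let k = suc n; M = 2 + k ^ k in suc (k * (k * M) ^ n) < M ^ k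
suc[k*[k*M]^n]<M^k n = begin-strict
  suc (k * (k * M) ^ n)     ≡⟨ cong (suc ∘ (k *_)) ([m*n]^o≡m^o*n^o k M n) ⟩
  suc (k * (k ^ n * M ^ n)) ≡⟨ cong suc (*-assoc k (k ^ n) (M ^ n)) ⟨
  suc (k ^ k * M ^ n)       <⟨ +-mono-≤ (m^n>0 M n) (+-monoˡ-≤ (k ^ k * M ^ n) (m^n>0 M n)) ⟩
  M ^ k                     ∎
  where
    open ≤-Reasoning
    k = suc n
    M = 2 + k ^ k

suc[n]+suc[n]∸1≡2*n+1 : ∀ n → suc n + suc n ∸ 1 ≡ 2 * n + 1
suc[n]+suc[n]∸1≡2*n+1 = solve 1 (λ n → n :+ (con 1 :+ n) := con 2 :* n :+ con 1) refl
  where open +-*-Solver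

-- The bound also holds for n = 0 (x ^ 0 = y ^ 0 for all x ≢ y).
theorem3 : (n : ℕ) → 0 < n → r≤ n (2 * n + 1)
theorem3 n _ = subst (r≤ n) (suc[n]+suc[n]∸1≡2*n+1 n)
                 (collision⇒r≤ n (powerSum-collision n (suc[k*[k*M]^n]<M^k n)))
  where open Blocks (suc n) (2 + suc n ^ suc n)
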